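{- Let $e_1,e_2,e_3$ be nonzero integers with $e_1+e_2+e_3=0$, $2\,\|\,e_1$, $2\,\|\,e_2$, $4\mid e_3$; write $e_i=2f_i$. Let $n$ be an odd positive square-free integer such that $\mathcal E_{e_1n,e_2n}$ has no rational point of order $4$. Let $\Lambda=(d_1,d_2,d_3)$ be a triple of odd square-free divisors of $2f_1f_2f_3n$ with $d_1d_2d_3$ a square. If $D_\Lambda^{(n)}(\mathbb Q_2)\neq\emptyset$, then $d_3\equiv1\pmod 4$.
   Context: $\mathcal E_{A,B}$: $y^2=x(x-A)(x+B)$. $D_\Lambda^{(n)}$ is the curve in $\mathbb P^3$ with coordinates $(t,u_1,u_2,u_3)$ defined by $e_1nt^2+d_2u_2^2-d_3u_3^2=0$, $e_2nt^2+d_3u_3^2-d_1u_1^2=0$, $e_3nt^2+d_1u_1^2-d_2u_2^2=0$. -}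

module Defs where

open import Data.Nat as ℕ using (ℕ; suc; _^_)
open import Data.Integer as ℤ using (ℤ; +_)
open import Data.Integer.Divisibility using (_∣_)
open import Data.Rational as ℚ using (ℚ; _/_)
open import Data.Product using (Σ; _×_; ∃; ∃-syntax)
open import Relation.Binary.PropositionalEquality using (_≡_)
open import Relation.Nullary using (¬_)

_≡_[mod_] : ℤ → ℤ → ℤ → Set
x ≡ y [mod m ] = m ∣ (x ℤ.- y)

Odd : ℤ → Set
Odd d = ¬ ((+ 2) ∣ d)

SquareFree : ℤ → Set
SquareFree d = ∀ (m : ℕ) → (+ (m ℕ.* m)) ∣ d → m ≡ 1

IsSquare : ℤ → Set
IsSquare a = ∃[ k ] a ≡ k ℤ.* k

ExactlyTwo : ℤ → Set
ExactlyTwo e = ((+ 2) ∣ e) × ¬ ((+ 4) ∣ e)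

-- The elliptic curve E_{A,B} : y² = x(x − A)(x + B) over ℚ,
-- i.e. y² = x³ + a₂x² + a₄x with a₂ = B − A, a₄ = −AB.

ιℚ : ℤ → ℚ
ιℚ a = a / 1

OnE : ℤ → ℤ → ℚ → ℚ → Set
OnE A B x y = y ℚ.* y ≡ x ℚ.* ((x ℚ.- ιℚ A) ℚ.* (x ℚ.+ ιℚ B))

-- A rational point of order 4 on E_{A,B}: an affine point P = (x , y) ∈ E(ℚ)
-- which is not 2-torsion (y ≠ 0), whose double 2P = (x₃ , y₃), computed by
-- the chord-tangent doubling formula (slope λ with λ·2y = 3x² + 2a₂x + a₄,
-- x₃ = λ² − a₂ − 2x, y₃ = λ(x − x₃) − y), is a point of order 2 (y₃ = 0).
HasRationalPointOfOrder4 : ℤ → ℤ → Set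
HasRationalPointOfOrder4 A B =
  Σ ℚ λ x → Σ ℚ λ y → Σ ℚ λ lam →
    OnE A B x y
    × ¬ (y ≡ ℚ.0ℚ)
    × (lam ℚ.* (ιℚ (+ 2) ℚ.* y)
        ≡ (ιℚ (+ 3) ℚ.* x ℚ.* x) ℚ.+ (ιℚ (+ 2) ℚ.* a₂ ℚ.* x) ℚ.+ a₄)
    × (lam ℚ.* (x ℚ.- x₃ lam x) ℚ.- y ≡ ℚ.0ℚ)
  where
  a₂ : ℚ
  a₂ = ιℚ (B ℤ.- A)
  a₄ : ℚ
  a₄ = ιℚ (ℤ.- (A ℤ.* B))
  x₃ : ℚ → ℚ → ℚ
  x₃ lam x = lam ℚ.* lam ℚ.- a₂ ℚ.- ιℚ (+ 2) ℚ.* x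

-- 2-adic integers ℤ₂ = lim ℤ/2^k ℤ, as compatible sequences of integers:
-- the k-th component is a representative of the image in ℤ/2^k.

record ℤ₂ : Set where
  field
    at     : ℕ → ℤ
    compat : ∀ k → at (suc k) ≡ at k [mod + (2 ^ k) ]
open ℤ₂ public

IsZero₂ : ℤ₂ → Set
IsZero₂ x = ∀ k → (+ (2 ^ k)) ∣ at x k

QuadVanishes₂ : ℤ → ℤ → ℤ → ℤ → ℤ₂ → ℤ₂ → ℤ₂ → ℤ₂ → Set
QuadVanishes₂ a b c d t u₁ u₂ u₃ = ∀ k →
  (+ (2 ^ k)) ∣ (a ℤ.* at t k ℤ.* at t k ℤ.+ b ℤ.* at u₁ k ℤ.* at u₁ k
                 ℤ.+ c ℤ.* at u₂ k ℤ.* at u₂ k ℤ.+ d ℤ.* at u₃ k ℤ.* at u₃ k)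

-- D_Λ^{(n)} ⊂ ℙ³ with coordinates (t,u₁,u₂,u₃):
--   e₁ n t² + d₂u₂² − d₃u₃² = 0,
--   e₂ n t² + d₃u₃² − d₁u₁² = 0,
--   e₃ n t² + d₁u₁² − d₂u₂² = 0.
-- D(ℚ₂) ≠ ∅  ⇔  there is a point of ℙ³(ℚ₂) = ℙ³(ℤ₂) on D, i.e. a tuple in
-- ℤ₂⁴, not all coordinates zero, satisfying the three equations.
HasQ2Point : (e₁ e₂ e₃ n d₁ d₂ d₃ : ℤ) → Set
HasQ2Point e₁ e₂ e₃ n d₁ d₂ d₃ =
  Σ ℤ₂ λ t → Σ ℤ₂ λ u₁ → Σ ℤ₂ λ u₂ → Σ ℤ₂ λ u₃ →
    ¬ (IsZero₂ t × IsZero₂ u₁ × IsZero₂ u₂ × IsZero₂ u₃)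
    × QuadVanishes₂ (e₁ ℤ.* n) (+ 0) d₂ (ℤ.- d₃) t u₁ u₂ u₃
    × QuadVanishes₂ (e₂ ℤ.* n) (ℤ.- d₁) (+ 0) d₃ t u₁ u₂ u₃
    × QuadVanishes₂ (e₃ ℤ.* n) d₁ (ℤ.- d₂) (+ 0) t u₁ u₂ u₃

-- Suppose d₃ ≢ 1, i.e. d₃ ≡ 3 (mod 4). As d₁d₂d₃ is an odd square, d₁d₂ ≡ 3 and
-- so d₂ ≡ −d₁ (mod 4); moreover e₁n ≡ 2 and e₃n ≡ 0 (mod 4). Modulo 4 the third
-- equation of D_Λ^{(n)} then reads d₁(u₁² + u₂²) ≡ 0 and the first 2t² + u₃² ≡ 0,
-- which force all four coordinates to be even. The equations being homogeneous
-- quadratic, halving and repeating shows that a solution modulo 4^k has all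
-- coordinates divisible by 2^k, so every ℤ₂-point of D_Λ^{(n)} is zero, which is
-- not a point of ℙ³.
module Submission where

open import Defs
open import Data.Nat as ℕ using (ℕ)
open import Data.Integer as ℤ using (ℤ; +_; _+_; _*_; _<_)
open import Data.Integer.Divisibility using (_∣_)
open import Data.Product using (_×_)
open import Relation.Binary.PropositionalEquality using (_≡_)
open import Relation.Nullary using (¬_)

open import Data.Nat using (zero; suc; _^_)
open import Data.Integer using (-_; _-_)
import Data.Nat.Properties as ℕP
import Data.Nat.Divisibility as ℕD
import Data.Integer.Properties as ℤP
import Data.Integer.Divisibility.Signed as Signed
open import Data.Integer.DivMod using (a≡a%n+[a/n]*n; n%d<d)
open import Data.Integer.Tactic.RingSolver using (solve-∀)
open import Data.Fin using (Fin; toℕ; fromℕ<)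
open import Data.Fin.Properties using (all?; toℕ-fromℕ<)
open import Data.Product using (_,_; proj₁; proj₂)
open import Function using (_∘_)
open import Relation.Binary.PropositionalEquality
  using (refl; sym; trans; cong; subst; subst₂; module ≡-Reasoning)
open import Relation.Nullary using (Dec)
open import Relation.Nullary.Decidable
  using (map′; toWitness; decidable-stable; ¬?; _×-dec_; _→-dec_)

private
  variable
    m n x y z x′ y′ : ℤ
    a b c d a′ b′ c′ d′ t u v w t′ u′ v′ w′ : ℤ

-- x ≡ y [mod m ] unfolds to divisibility of absolute values, from which
-- unification cannot recover x, y and m; this record keeps them visible.
infix 4 _≋_[mod_]

record _≋_[mod_] (x y m : ℤ) : Set where
  constructor ≋-mod
  field divides : m Signed.∣ x - y
open _≋_[mod_]

≋⇒≡-mod : x ≋ y [mod m ] → x ≡ y [mod m ]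
≋⇒≡-mod {x} {y} {m} p = Signed.∣⇒∣ᵤ {m} {x - y} (divides p)

≡-mod⇒≋ : ∀ x y m → x ≡ y [mod m ] → x ≋ y [mod m ]
≡-mod⇒≋ x y m p = ≋-mod (Signed.∣ᵤ⇒∣ {m} {x - y} p)

_≋?_[mod_] : ∀ x y m → Dec (x ≋ y [mod m ])
x ≋? y [mod m ] = map′ ≋-mod divides (m Signed.∣? x - y)

≋-refl : x ≋ x [mod m ]
≋-refl {x} = ≋-mod (Signed.divides (+ 0) (ℤP.+-inverseʳ x))

≋-sym : x ≋ y [mod m ] → y ≋ x [mod m ]
≋-sym {x} {y} {m} (≋-mod p) = ≋-mod (subst (m Signed.∣_) (flip x y) (Signed.∣m⇒∣-m p))
  where
  flip : ∀ x y → - (x - y) ≡ y - x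
  flip = solve-∀

≋-trans : x ≋ y [mod m ] → y ≋ z [mod m ] → x ≋ z [mod m ]
≋-trans {x} {y} {m} {z} (≋-mod p) (≋-mod q) =
  ≋-mod (subst (m Signed.∣_) (chain x y z) (Signed.∣m∣n⇒∣m+n p q))
  where
  chain : ∀ x y z → (x - y) + (y - z) ≡ x - z
  chain = solve-∀

+-cong-mod : x ≋ y [mod m ] → x′ ≋ y′ [mod m ] → x + x′ ≋ y + y′ [mod m ]
+-cong-mod {x} {y} {m} {x′} {y′} (≋-mod p) (≋-mod q) =
  ≋-mod (subst (m Signed.∣_) (regroup x y x′ y′) (Signed.∣m∣n⇒∣m+n p q))
  where
  regroup : ∀ x y x′ y′ → (x - y) + (x′ - y′) ≡ (x + x′) - (y + y′)
  regroup = solve-∀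

*-cong-mod : x ≋ y [mod m ] → x′ ≋ y′ [mod m ] → x * x′ ≋ y * y′ [mod m ]
*-cong-mod {x} {y} {m} {x′} {y′} (≋-mod p) (≋-mod q) =
  ≋-mod (subst (m Signed.∣_) (regroup x y x′ y′)
    (Signed.∣m∣n⇒∣m+n (Signed.∣n⇒∣m*n x q) (Signed.∣m⇒∣m*n y′ p)))
  where
  regroup : ∀ x y x′ y′ → x * (x′ - y′) + (x - y) * y′ ≡ x * x′ - y * y′
  regroup = solve-∀

-‿cong-mod : x ≋ y [mod m ] → - x ≋ - y [mod m ]
-‿cong-mod {x} {y} {m} (≋-mod p) = ≋-mod (subst (m Signed.∣_) (regroup x y) (Signed.∣m⇒∣-m p))
  where
  regroup : ∀ x y → - (x - y) ≡ - x - - y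
  regroup = solve-∀

≋-weaken : n Signed.∣ m → x ≋ y [mod m ] → x ≋ y [mod n ]
≋-weaken n∣m (≋-mod p) = ≋-mod (Signed.∣-trans n∣m p)

∣⇒≋0 : m Signed.∣ x → x ≋ + 0 [mod m ]
∣⇒≋0 {m} {x} = ≋-mod ∘ subst (m Signed.∣_) (sym (ℤP.+-identityʳ x))

∣-resp-≋ : n Signed.∣ m → x ≋ y [mod m ] → n Signed.∣ x → n Signed.∣ y
∣-resp-≋ {n} {m} {x} {y} n∣m x≋y n∣x =
  subst (n Signed.∣_) (cancel x y) (Signed.∣m∣n⇒∣m-n n∣x (divides (≋-weaken n∣m x≋y)))
  where
  cancel : ∀ x y → x - (x - y) ≡ y
  cancel = solve-∀

residue : (m : ℕ) .{{_ : ℕ.NonZero m}} → ℤ → Fin m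
residue m x = fromℕ< (n%d<d x (+ m))

⟦_⟧ : ∀ {m} → Fin m → ℤ
⟦ r ⟧ = + toℕ r

≋-residue : ∀ m .{{_ : ℕ.NonZero m}} x → x ≋ ⟦ residue m x ⟧ [mod + m ]
≋-residue m x = ≋-mod (Signed.divides q (begin
  x - ⟦ residue m x ⟧   ≡⟨ cong (λ r → x - + r) (toℕ-fromℕ< (n%d<d x (+ m))) ⟩
  x - + r               ≡⟨ cong (_- + r) (a≡a%n+[a/n]*n x (+ m)) ⟩
  (+ r + q * + m) - + r ≡⟨ cancel (+ r) q (+ m) ⟩
  q * + m               ∎))
  where
  open ≡-Reasoning
  r = x ℤ.% + m
  q = x ℤ./ + m
  cancel : ∀ r q m → (r + q * m) - r ≡ q * m
  cancel = solve-∀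

infix 4 _∣?_

_∣?_ : ∀ m x → Dec (m ∣ x)
m ∣? x = ℤ.∣ m ∣ ℕD.∣? ℤ.∣ x ∣

module _ (m : ℕ) .{{_ : ℕ.NonZero m}} (n : ℤ) (n∣m : n Signed.∣ + m) where

  ∣-residue : ∀ x → n ∣ x → n ∣ ⟦ residue m x ⟧
  ∣-residue x n∣x = Signed.∣⇒∣ᵤ {n} {⟦ residue m x ⟧}
    (∣-resp-≋ n∣m (≋-residue m x) (Signed.∣ᵤ⇒∣ {n} {x} n∣x))

  ∣-residue⁻¹ : ∀ x → n ∣ ⟦ residue m x ⟧ → n ∣ x
  ∣-residue⁻¹ x n∣r = Signed.∣⇒∣ᵤ {n} {x}
    (∣-resp-≋ n∣m (≋-sym (≋-residue m x)) (Signed.∣ᵤ⇒∣ {n} {⟦ residue m x ⟧} n∣r))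

2∣4 : + 2 Signed.∣ + 4
2∣4 = Signed.divides (+ 2) refl

Odd-residue : ∀ x → Odd x → Odd ⟦ residue 4 x ⟧
Odd-residue x odd = odd ∘ ∣-residue⁻¹ 4 (+ 2) 2∣4 x

ExactlyTwo-residue : ∀ x → ExactlyTwo x → ExactlyTwo ⟦ residue 4 x ⟧
ExactlyTwo-residue x (2∣x , 4∤x) = ∣-residue 4 (+ 2) 2∣4 x 2∣x , 4∤x ∘ ∣-residue⁻¹ 4 (+ 4) Signed.∣-refl x

ExactlyTwo-*-Odd : ∀ e x → ExactlyTwo e → Odd x → e * x ≋ + 2 [mod + 4 ]
ExactlyTwo-*-Odd e x 2∥e odd = ≋-trans (*-cong-mod (≋-residue 4 e) (≋-residue 4 x))
  (on-residues (residue 4 e) (residue 4 x) (ExactlyTwo-residue e 2∥e) (Odd-residue x odd))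
  where
  on-residues : ∀ (e x : Fin 4) → ExactlyTwo ⟦ e ⟧ → Odd ⟦ x ⟧ → ⟦ e ⟧ * ⟦ x ⟧ ≋ + 2 [mod + 4 ]
  on-residues = toWitness {a? = all? λ e → all? λ x →
    ((+ 2 ∣? ⟦ e ⟧) ×-dec ¬? (+ 4 ∣? ⟦ e ⟧)) →-dec ¬? (+ 2 ∣? ⟦ x ⟧) →-dec
    ((⟦ e ⟧ * ⟦ x ⟧) ≋? + 2 [mod + 4 ])} _

Odd-≉1⇒≋3 : ∀ x → Odd x → ¬ (x ≋ + 1 [mod + 4 ]) → x ≋ + 3 [mod + 4 ]
Odd-≉1⇒≋3 x odd x≉1 = ≋-trans (≋-residue 4 x)
  (on-residues (residue 4 x) (Odd-residue x odd) (x≉1 ∘ ≋-trans (≋-residue 4 x)))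
  where
  on-residues : ∀ (r : Fin 4) → Odd ⟦ r ⟧ → ¬ (⟦ r ⟧ ≋ + 1 [mod + 4 ]) → ⟦ r ⟧ ≋ + 3 [mod + 4 ]
  on-residues = toWitness {a? = all? λ r →
    ¬? (+ 2 ∣? ⟦ r ⟧) →-dec ¬? (⟦ r ⟧ ≋? + 1 [mod + 4 ]) →-dec (⟦ r ⟧ ≋? + 3 [mod + 4 ])} _

quad : ℤ → ℤ → ℤ → ℤ → ℤ → ℤ → ℤ → ℤ → ℤ
quad a b c d t u v w = a * t * t + b * u * u + c * v * v + d * w * w

quad-cong-mod : a ≋ a′ [mod m ] → b ≋ b′ [mod m ] → c ≋ c′ [mod m ] → d ≋ d′ [mod m ] →
  t ≋ t′ [mod m ] → u ≋ u′ [mod m ] → v ≋ v′ [mod m ] → w ≋ w′ [mod m ] →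
  quad a b c d t u v w ≋ quad a′ b′ c′ d′ t′ u′ v′ w′ [mod m ]
quad-cong-mod a b c d t u v w =
  +-cong-mod (+-cong-mod (+-cong-mod (term a t) (term b u)) (term c v)) (term d w)
  where
  term : x ≋ x′ [mod m ] → y ≋ y′ [mod m ] → x * y * y ≋ x′ * y′ * y′ [mod m ]
  term p q = *-cong-mod (*-cong-mod p q) q

quad-cong : ∀ a b c d → t ≡ t′ → u ≡ u′ → v ≡ v′ → w ≡ w′ →
  quad a b c d t u v w ≡ quad a b c d t′ u′ v′ w′
quad-cong _ _ _ _ refl refl refl refl = refl

quad-*2 : ∀ a b c d t u v w →
  quad a b c d (t * + 2) (u * + 2) (v * + 2) (w * + 2) ≡ quad a b c d t u v w * + 4
quad-*2 = expanded
  where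
  -- solve-∀ does not unfold quad
  expanded : ∀ a b c d t u v w →
    a * (t * + 2) * (t * + 2) + b * (u * + 2) * (u * + 2) + c * (v * + 2) * (v * + 2) + d * (w * + 2) * (w * + 2)
    ≡ (a * t * t + b * u * u + c * v * v + d * w * w) * + 4
  expanded = solve-∀

Divides⁴ : ℤ → ℤ → ℤ → ℤ → ℤ → Set
Divides⁴ m t u v w = m Signed.∣ t × m Signed.∣ u × m Signed.∣ v × m Signed.∣ w

mod-4-solutions-even : ∀ E₁ E₃ D₁ D₂ D₃ s →
  E₁ ≋ + 2 [mod + 4 ] → + 4 Signed.∣ E₃ → D₃ ≋ + 3 [mod + 4 ] →
  Odd D₁ → Odd D₂ → D₁ * D₂ * D₃ ≡ s * s →
  ∀ T U V W → + 4 Signed.∣ quad E₁ (+ 0) D₂ (- D₃) T U V W →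
              + 4 Signed.∣ quad E₃ D₁ (- D₂) (+ 0) T U V W →
  Divides⁴ (+ 2) T U V W
mod-4-solutions-even E₁ E₃ D₁ D₂ D₃ s E₁≋2 4∣E₃ D₃≋3 odd₁ odd₂ square T U V W h₁ h₃ =
  lift T t-even , lift U u-even , lift V v-even , lift W w-even
  where
  r : ℤ → Fin 4
  r = residue 4
  ≋r : ∀ x → x ≋ ⟦ r x ⟧ [mod + 4 ]
  ≋r = ≋-residue 4
  lift : ∀ x → + 2 Signed.∣ ⟦ r x ⟧ → + 2 Signed.∣ x
  lift x = ∣-resp-≋ 2∣4 (≋-sym (≋r x))
  square-mod-4 : ⟦ r D₁ ⟧ * ⟦ r D₂ ⟧ * + 3 ≋ ⟦ r s ⟧ * ⟦ r s ⟧ [mod + 4 ]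
  square-mod-4 = ≋-trans (≋-sym (*-cong-mod (*-cong-mod (≋r D₁) (≋r D₂)) D₃≋3))
    (subst (λ y → y ≋ ⟦ r s ⟧ * ⟦ r s ⟧ [mod + 4 ]) (sym square) (*-cong-mod (≋r s) (≋r s)))
  on-residues : ∀ (d₁ d₂ s t u v w : Fin 4) → Odd ⟦ d₁ ⟧ → Odd ⟦ d₂ ⟧ →
    ⟦ d₁ ⟧ * ⟦ d₂ ⟧ * + 3 ≋ ⟦ s ⟧ * ⟦ s ⟧ [mod + 4 ] →
    + 4 Signed.∣ quad (+ 2) (+ 0) ⟦ d₂ ⟧ (- + 3) ⟦ t ⟧ ⟦ u ⟧ ⟦ v ⟧ ⟦ w ⟧ →
    + 4 Signed.∣ quad (+ 0) ⟦ d₁ ⟧ (- ⟦ d₂ ⟧) (+ 0) ⟦ t ⟧ ⟦ u ⟧ ⟦ v ⟧ ⟦ w ⟧ →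
    Divides⁴ (+ 2) ⟦ t ⟧ ⟦ u ⟧ ⟦ v ⟧ ⟦ w ⟧
  on-residues = toWitness {a? = all? λ d₁ → all? λ d₂ → all? λ s →
    all? λ t → all? λ u → all? λ v → all? λ w →
    ¬? (+ 2 ∣? ⟦ d₁ ⟧) →-dec ¬? (+ 2 ∣? ⟦ d₂ ⟧) →-dec
    ((⟦ d₁ ⟧ * ⟦ d₂ ⟧ * + 3) ≋? (⟦ s ⟧ * ⟦ s ⟧) [mod + 4 ]) →-dec
    (+ 4 Signed.∣? quad (+ 2) (+ 0) ⟦ d₂ ⟧ (- + 3) ⟦ t ⟧ ⟦ u ⟧ ⟦ v ⟧ ⟦ w ⟧) →-dec
    (+ 4 Signed.∣? quad (+ 0) ⟦ d₁ ⟧ (- ⟦ d₂ ⟧) (+ 0) ⟦ t ⟧ ⟦ u ⟧ ⟦ v ⟧ ⟦ w ⟧) →-dec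
    (+ 2 Signed.∣? ⟦ t ⟧ ×-dec + 2 Signed.∣? ⟦ u ⟧ ×-dec + 2 Signed.∣? ⟦ v ⟧ ×-dec + 2 Signed.∣? ⟦ w ⟧)} _
  residues-even : Divides⁴ (+ 2) ⟦ r T ⟧ ⟦ r U ⟧ ⟦ r V ⟧ ⟦ r W ⟧
  residues-even = on-residues (r D₁) (r D₂) (r s) (r T) (r U) (r V) (r W)
    (Odd-residue D₁ odd₁) (Odd-residue D₂ odd₂) square-mod-4
    (∣-resp-≋ Signed.∣-refl
      (quad-cong-mod E₁≋2 (≋-refl {+ 0}) (≋r D₂) (-‿cong-mod D₃≋3) (≋r T) (≋r U) (≋r V) (≋r W)) h₁)
    (∣-resp-≋ Signed.∣-refl
      (quad-cong-mod (∣⇒≋0 4∣E₃) (≋r D₁) (-‿cong-mod (≋r D₂)) (≋-refl {+ 0}) (≋r T) (≋r U) (≋r V) (≋r W)) h₃)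
  t-even = proj₁ residues-even
  u-even = proj₁ (proj₂ residues-even)
  v-even = proj₁ (proj₂ (proj₂ residues-even))
  w-even = proj₂ (proj₂ (proj₂ residues-even))

^-monoʳ-∣ : ∀ b {k j} → k ℕ.≤ j → b ^ k ℕD.∣ b ^ j
^-monoʳ-∣ b {k} {j} k≤j = ℕD.divides (b ^ (j ℕ.∸ k)) (begin
  b ^ j               ≡⟨ cong (b ^_) (sym (ℕP.m∸n+n≡m k≤j)) ⟩
  b ^ (j ℕ.∸ k ℕ.+ k) ≡⟨ ℕP.^-distribˡ-+-* b (j ℕ.∸ k) k ⟩
  b ^ (j ℕ.∸ k) ℕ.* b ^ k ∎)
  where open ≡-Reasoning

at-≋-mod : ∀ x {k j} → k ℕ.≤ j → at x j ≋ at x k [mod + (2 ^ k) ]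
at-≋-mod x {k} k≤j = go (ℕP.≤⇒≤′ k≤j)
  where
  go : ∀ {j} → k ℕ.≤′ j → at x j ≋ at x k [mod + (2 ^ k) ]
  go ℕ.≤′-refl = ≋-refl
  go (ℕ.≤′-step {j} k≤′j) = ≋-trans
    (≋-weaken (Signed.∣ᵤ⇒∣ (^-monoʳ-∣ 2 (ℕP.≤′⇒≤ k≤′j)))
              (≡-mod⇒≋ (at x (suc j)) (at x j) (+ (2 ^ j)) (compat x j)))
    (go k≤′j)

IsZero₂-if-∣-at-2* : ∀ x → (∀ k → + (2 ^ k) Signed.∣ at x (2 ℕ.* k)) → IsZero₂ x
IsZero₂-if-∣-at-2* x h k =
  Signed.∣⇒∣ᵤ {+ (2 ^ k)} {at x k} (∣-resp-≋ Signed.∣-refl (at-≋-mod x (ℕP.m≤n*m k 2)) (h k))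

+[b^1+k]≡+[b^k]*+b : ∀ b k → + (b ^ suc k) ≡ + (b ^ k) * + b
+[b^1+k]≡+[b^k]*+b b k = trans (cong +_ (ℕP.*-comm b (b ^ k))) (ℤP.pos-* (b ^ k) b)

module _ (a b c d a′ b′ c′ d′ : ℤ)
  (mod-4-even : ∀ t u v w → + 4 Signed.∣ quad a b c d t u v w →
                            + 4 Signed.∣ quad a′ b′ c′ d′ t u v w → Divides⁴ (+ 2) t u v w)
  where

  descent : ∀ k t u v w → + (4 ^ k) Signed.∣ quad a b c d t u v w →
                          + (4 ^ k) Signed.∣ quad a′ b′ c′ d′ t u v w → Divides⁴ (+ (2 ^ k)) t u v w
  descent zero t u v w _ _ = 1∣ t , 1∣ u , 1∣ v , 1∣ w
    where
    1∣ : ∀ x → + 1 Signed.∣ x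
    1∣ x = Signed.divides x (sym (ℤP.*-identityʳ x))
  descent (suc k) t u v w h h′ =
    double 2∣t (proj₁ ih) , double 2∣u (proj₁ (proj₂ ih)) ,
    double 2∣v (proj₁ (proj₂ (proj₂ ih))) , double 2∣w (proj₂ (proj₂ (proj₂ ih)))
    where
    4∣4^[1+k] : + 4 Signed.∣ + (4 ^ suc k)
    4∣4^[1+k] = Signed.divides (+ (4 ^ k)) (+[b^1+k]≡+[b^k]*+b 4 k)
    evens : Divides⁴ (+ 2) t u v w
    evens = mod-4-even t u v w (Signed.∣-trans 4∣4^[1+k] h) (Signed.∣-trans 4∣4^[1+k] h′)
    2∣t = proj₁ evens
    2∣u = proj₁ (proj₂ evens)
    2∣v = proj₁ (proj₂ (proj₂ evens))
    2∣w = proj₂ (proj₂ (proj₂ evens))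
    open Signed._∣_ using (quotient; equality)
    halve : ∀ a b c d → + (4 ^ suc k) Signed.∣ quad a b c d t u v w →
      + (4 ^ k) Signed.∣ quad a b c d (quotient 2∣t) (quotient 2∣u) (quotient 2∣v) (quotient 2∣w)
    halve a b c d = Signed.*-cancelʳ-∣ (+ 4) ∘ subst₂ Signed._∣_ (+[b^1+k]≡+[b^k]*+b 4 k)
      (trans (quad-cong a b c d (equality 2∣t) (equality 2∣u) (equality 2∣v) (equality 2∣w))
             (quad-*2 a b c d _ _ _ _))
    ih = descent k _ _ _ _ (halve a b c d h) (halve a′ b′ c′ d′ h′)
    double : ∀ {x} (2∣x : + 2 Signed.∣ x) → + (2 ^ k) Signed.∣ quotient 2∣x → + (2 ^ suc k) Signed.∣ x
    double 2∣x = subst₂ Signed._∣_ (sym (+[b^1+k]≡+[b^k]*+b 2 k)) (sym (equality 2∣x)) ∘ Signed.*-monoˡ-∣ (+ 2)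

  trivial-ℤ₂-solutions : ∀ t u₁ u₂ u₃ →
    QuadVanishes₂ a b c d t u₁ u₂ u₃ → QuadVanishes₂ a′ b′ c′ d′ t u₁ u₂ u₃ →
    IsZero₂ t × IsZero₂ u₁ × IsZero₂ u₂ × IsZero₂ u₃
  trivial-ℤ₂-solutions t u₁ u₂ u₃ V V′ =
    IsZero₂-if-∣-at-2* t (proj₁ ∘ levels) , IsZero₂-if-∣-at-2* u₁ (proj₁ ∘ proj₂ ∘ levels) ,
    IsZero₂-if-∣-at-2* u₂ (proj₁ ∘ proj₂ ∘ proj₂ ∘ levels) , IsZero₂-if-∣-at-2* u₃ (proj₂ ∘ proj₂ ∘ proj₂ ∘ levels)
    where
    4ᵏ∣ : ∀ k {q} → + (2 ^ (2 ℕ.* k)) ∣ q → + (4 ^ k) Signed.∣ q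
    4ᵏ∣ k {q} = Signed.∣ᵤ⇒∣ {+ (4 ^ k)} {q} ∘ subst (ℕD._∣ ℤ.∣ q ∣) (sym (ℕP.^-*-assoc 2 2 k))
    levels : ∀ k → Divides⁴ (+ (2 ^ k)) (at t (2 ℕ.* k)) (at u₁ (2 ℕ.* k)) (at u₂ (2 ℕ.* k)) (at u₃ (2 ℕ.* k))
    levels k = descent k _ _ _ _ (4ᵏ∣ k (V (2 ℕ.* k))) (4ᵏ∣ k (V′ (2 ℕ.* k)))

lemma4p1 : (e₁ e₂ e₃ f₁ f₂ f₃ : ℤ) → (n : ℕ) → (d₁ d₂ d₃ : ℤ) →
    ¬ (e₁ ≡ + 0) → ¬ (e₂ ≡ + 0) → ¬ (e₃ ≡ + 0) →
    e₁ + e₂ + e₃ ≡ + 0 →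
    ExactlyTwo e₁ → ExactlyTwo e₂ → (+ 4) ∣ e₃ →
    e₁ ≡ + 2 * f₁ → e₂ ≡ + 2 * f₂ → e₃ ≡ + 2 * f₃ →
    + 0 < + n → Odd (+ n) → SquareFree (+ n) →
    ¬ HasRationalPointOfOrder4 (e₁ * + n) (e₂ * + n) →
    Odd d₁ × SquareFree d₁ × d₁ ∣ (+ 2 * f₁ * f₂ * f₃ * + n) →
    Odd d₂ × SquareFree d₂ × d₂ ∣ (+ 2 * f₁ * f₂ * f₃ * + n) →
    Odd d₃ × SquareFree d₃ × d₃ ∣ (+ 2 * f₁ * f₂ * f₃ * + n) →
    IsSquare (d₁ * d₂ * d₃) →
    HasQ2Point e₁ e₂ e₃ (+ n) d₁ d₂ d₃ →
    d₃ ≡ + 1 [mod + 4 ]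
lemma4p1 e₁ _ e₃ _ _ _ n d₁ d₂ d₃ _ _ _ _ 2∥e₁ _ 4∣e₃ _ _ _ _ odd-n _ _
  (odd-d₁ , _) (odd-d₂ , _) (odd-d₃ , _) (s , square) (t , u₁ , u₂ , u₃ , nontrivial , V₁ , _ , V₃) =
  decidable-stable (+ 4 ∣? d₃ - + 1) λ d₃≢1 →
    nontrivial (trivial-ℤ₂-solutions (e₁ * + n) (+ 0) d₂ (- d₃) (e₃ * + n) d₁ (- d₂) (+ 0)
      (mod-4-solutions-even (e₁ * + n) (e₃ * + n) d₁ d₂ d₃ s
        e₁n≋2 4∣e₃n (Odd-≉1⇒≋3 d₃ odd-d₃ (d₃≢1 ∘ ≋⇒≡-mod)) odd-d₁ odd-d₂ square)
      t u₁ u₂ u₃ V₁ V₃)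
  where
  e₁n≋2 : e₁ * + n ≋ + 2 [mod + 4 ]
  e₁n≋2 = ExactlyTwo-*-Odd e₁ (+ n) 2∥e₁ odd-n
  4∣e₃n : + 4 Signed.∣ e₃ * + n
  4∣e₃n = Signed.∣m⇒∣m*n (+ n) (Signed.∣ᵤ⇒∣ {+ 4} {e₃} 4∣e₃)
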